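{- Let $\mathcal{X}$ be a weakly flag-transitive symmetric configuration $v_3$. Then $\mathcal{X}$ is flag-transitive.
   Context: A symmetric configuration $v_3$ is a pair $(V,\mathcal{B})$ where $V$ is a set of $v$ points and $\mathcal{B}$ is a set of $v$ three-element subsets of $V$ (blocks) such that each point lies in exactly $3$ blocks and any two distinct points lie in at most one block; configurations are assumed connected (their point-block incidence graph is connected). An automorphism of $\mathcal{X}$ is a permutation of the points together with the induced permutation of the blocks that preserves incidence (points to points, blocks to blocks); $\mathrm{Aut}(\mathcal{X})$ is the group of automorphisms. An anti-automorphism is an incidence-preserving bijection mapping points to blocks and blocks to points; $A(\mathcal{X})$ denotes the group of all automorphisms and anti-automorphisms. A flag is an ordered pair $(p,B)$ with $p$ a point, $B$ a block and $p\in B$. $\mathcal{X}$ is flag-transitive if $\mathrm{Aut}(\mathcal{X})$ acts transitively on the set of flags, and weakly flag-transitive if $A(\mathcal{X})$ acts transitively on the set of flags regarded as unordered pairs $\{p,B\}$. -}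

module Defs where

open import Data.Nat using (ℕ; zero; suc)
open import Data.Bool using (Bool; true; false; if_then_else_)
open import Data.Fin using (Fin; zero; suc)
open import Data.Fin.Permutation using (Permutation′; _⟨$⟩ʳ_)
open import Data.Sum using (_⊎_; inj₁; inj₂)
open import Data.Product using (Σ; _×_; _,_)
open import Relation.Binary.PropositionalEquality using (_≡_; _≢_)

countTrue : ∀ {n} → (Fin n → Bool) → ℕ
countTrue {zero}  f = zero
countTrue {suc n} f = (if f zero then suc else (λ k → k)) (countTrue (λ i → f (suc i)))

-- Vertices of the point-block incidence (Levi) graph: points are inj₁, blocks inj₂.
Vertex : ℕ → Set
Vertex v = Fin v ⊎ Fin v

data Adj {v : ℕ} (inc : Fin v → Fin v → Bool) : Vertex v → Vertex v → Set where
  pb : ∀ p b → inc p b ≡ true → Adj inc (inj₁ p) (inj₂ b)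
  bp : ∀ p b → inc p b ≡ true → Adj inc (inj₂ b) (inj₁ p)

data Reach {v : ℕ} (inc : Fin v → Fin v → Bool) : Vertex v → Vertex v → Set where
  here : ∀ x → Reach inc x x
  step : ∀ {x y z} → Adj inc x y → Reach inc y z → Reach inc x z

-- A connected symmetric configuration v_3, given by its incidence relation between
-- v points (Fin v) and v blocks (Fin v): inc p B ≡ true iff point p lies in block B.
-- Each block has exactly 3 points; each point lies in exactly 3 blocks; two distinct
-- points lie in at most one common block (this also forces distinct blocks to be
-- distinct 3-subsets); the incidence graph is connected.
record IsConfiguration (v : ℕ) (inc : Fin v → Fin v → Bool) : Set where
  field
    blockSize   : ∀ B → countTrue (λ p → inc p B) ≡ 3
    pointDegree : ∀ p → countTrue (λ B → inc p B) ≡ 3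
    linear      : ∀ p q B C → p ≢ q →
                  inc p B ≡ true → inc q B ≡ true →
                  inc p C ≡ true → inc q C ≡ true → B ≡ C
    connected   : ∀ x y → Reach inc x y

record Automorphism (v : ℕ) (inc : Fin v → Fin v → Bool) : Set where
  field
    σ : Permutation′ v
    τ : Permutation′ v
    preserves : ∀ p B → inc (σ ⟨$⟩ʳ p) (τ ⟨$⟩ʳ B) ≡ inc p B

record AntiAutomorphism (v : ℕ) (inc : Fin v → Fin v → Bool) : Set where
  field
    α : Permutation′ v
    β : Permutation′ v
    preserves : ∀ p B → inc (β ⟨$⟩ʳ B) (α ⟨$⟩ʳ p) ≡ inc p B

FlagTransitive : (v : ℕ) → (Fin v → Fin v → Bool) → Set
FlagTransitive v inc =
  ∀ p B q C → inc p B ≡ true → inc q C ≡ true →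
  Σ (Automorphism v inc) λ g →
    (Automorphism.σ g ⟨$⟩ʳ p ≡ q) × (Automorphism.τ g ⟨$⟩ʳ B ≡ C)

-- Weakly flag-transitive: A(X) = automorphisms ∪ anti-automorphisms is transitive
-- on unordered flags {p, B}: some automorphism maps p ↦ q, B ↦ C, or some
-- anti-automorphism maps p ↦ C, B ↦ q.
WeaklyFlagTransitive : (v : ℕ) → (Fin v → Fin v → Bool) → Set
WeaklyFlagTransitive v inc =
  ∀ p B q C → inc p B ≡ true → inc q C ≡ true →
  (Σ (Automorphism v inc) λ g →
     (Automorphism.σ g ⟨$⟩ʳ p ≡ q) × (Automorphism.τ g ⟨$⟩ʳ B ≡ C))
  ⊎
  (Σ (AntiAutomorphism v inc) λ h →
     (AntiAutomorphism.α h ⟨$⟩ʳ p ≡ C) × (AntiAutomorphism.β h ⟨$⟩ʳ B ≡ q))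

module Submission where

-- Fix a flag (p, B). By weak flag-transitivity any flag (q, C) is the image of (p, B)
-- under an automorphism or of (B, p) under an anti-automorphism h; in the second case,
-- precomposing h with an element of A(X) that swaps p and B yields an automorphism.
-- Such a swap exists: otherwise each flag is an A(X)-image of (p, B) in exactly one
-- orientation, so the number of flags at a vertex z in which z plays the role of p is
-- A(X)-invariant. It takes the values d₁ at p and d₂ at B, hence {d₁, d₂} at the two
-- ends of every flag, and by connectivity d₁ at every point and d₂ at every block.
-- Counting flags gives v d₁ + v d₂ = 3v, while h sends p to a block, forcing d₁ = d₂
-- and 2 d₁ = 3.

open import Defs
open import Level using (0ℓ)
open import Data.Nat using (ℕ; zero; suc; _+_; _*_)
open import Data.Nat.Properties using (+-suc; *-distribˡ-+; *-cancelˡ-≡; +-0-commutativeMonoid)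
open import Data.Bool using (Bool; true; false; _∧_; not; if_then_else_)
open import Data.Fin using (Fin; zero; suc)
open import Data.Fin.Properties using (nonZeroIndex)
open import Data.Fin.Permutation using (Permutation′; _⟨$⟩ʳ_; _∘ₚ_; flip; inverseˡ; inverseʳ)
open import Data.Sum using (_⊎_; inj₁; inj₂; [_,_]′; map₂)
open import Data.Product using (Σ; _×_; _,_)
open import Data.Empty using (⊥-elim)
open import Function using (_∘_; id)
open import Effect.Monad using (RawMonad)
open import Relation.Binary.PropositionalEquality
  using (_≡_; _≢_; _≗_; refl; sym; trans; cong; cong₂; subst; subst₂; module ≡-Reasoning)
open import Algebra.Properties.CommutativeMonoid.Sum +-0-commutativeMonoid
  using (sum-syntax; sum-cong-≗; ∑-comm; ∑-distrib-+; sum-permute)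
import Data.Sum.Effectful.Left as SumLeft

sequenceFin : ∀ {n e p} {E : Set e} {P : Fin n → Set p} →
              (∀ i → E ⊎ P i) → E ⊎ (∀ i → P i)
sequenceFin {zero}          f = inj₂ λ ()
sequenceFin {suc n} {P = P} f with f zero | sequenceFin {P = P ∘ suc} (f ∘ suc)
... | inj₁ e  | _       = inj₁ e
... | inj₂ _  | inj₁ e  = inj₁ e
... | inj₂ p₀ | inj₂ ps = inj₂ λ { zero → p₀ ; (suc i) → ps i }

pair-cancel : ∀ {a} {A : Set a} {x y m n m′ n′ : A} →
              (m ≡ x × n ≡ y) ⊎ (m ≡ y × n ≡ x) →
              (m′ ≡ x × n′ ≡ y) ⊎ (m′ ≡ y × n′ ≡ x) →
              m ≡ m′ → n ≡ n′
pair-cancel (inj₁ (refl , refl)) (inj₁ (refl , refl)) _    = refl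
pair-cancel (inj₁ (refl , refl)) (inj₂ (refl , refl)) m≡m′ = sym m≡m′
pair-cancel (inj₂ (refl , refl)) (inj₁ (refl , refl)) m≡m′ = sym m≡m′
pair-cancel (inj₂ (refl , refl)) (inj₂ (refl , refl)) _    = refl

n+n≢3 : ∀ n → n + n ≢ 3
n+n≢3 (suc (suc n)) eq rewrite +-suc n (suc n) | +-suc n n with eq
... | ()

∑-const : ∀ n c → ∑[ i < n ] c ≡ n * c
∑-const zero    c = refl
∑-const (suc n) c = cong (c +_) (∑-const n c)

indicator : Bool → ℕ
indicator b = if b then 1 else 0

countTrue≡∑ : ∀ {n} (f : Fin n → Bool) → countTrue f ≡ ∑[ i < n ] indicator (f i)
countTrue≡∑ {zero}  f = refl
countTrue≡∑ {suc n} f with f zero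
... | true  = cong suc (countTrue≡∑ (f ∘ suc))
... | false = countTrue≡∑ (f ∘ suc)

countTrue-cong : ∀ {n} {f g : Fin n → Bool} → f ≗ g → countTrue f ≡ countTrue g
countTrue-cong {f = f} {g} f≗g = begin
  countTrue f                ≡⟨ countTrue≡∑ f ⟩
  ∑[ i < _ ] indicator (f i) ≡⟨ sum-cong-≗ (cong indicator ∘ f≗g) ⟩
  ∑[ i < _ ] indicator (g i) ≡⟨ countTrue≡∑ g ⟨
  countTrue g                ∎
  where open ≡-Reasoning

countTrue-permute : ∀ {n} (f : Fin n → Bool) (π : Permutation′ n) →
                    countTrue f ≡ countTrue (f ∘ (π ⟨$⟩ʳ_))
countTrue-permute f π = begin
  countTrue f                        ≡⟨ countTrue≡∑ f ⟩
  ∑[ i < _ ] indicator (f i)         ≡⟨ sum-permute (indicator ∘ f) π ⟩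
  ∑[ i < _ ] indicator (f (π ⟨$⟩ʳ i)) ≡⟨ countTrue≡∑ (f ∘ (π ⟨$⟩ʳ_)) ⟨
  countTrue (f ∘ (π ⟨$⟩ʳ_))          ∎
  where open ≡-Reasoning

∑-countTrue-split : ∀ {m n} (r t : Fin m → Fin n → Bool) →
  ∑[ x < m ] countTrue (λ y → r x y ∧ t x y) + ∑[ y < n ] countTrue (λ x → r x y ∧ not (t x y))
    ≡ ∑[ x < m ] countTrue (r x)
∑-countTrue-split {m} {n} r t = begin
  ∑[ x < m ] countTrue (λ y → r x y ∧ t x y) + ∑[ y < n ] countTrue (λ x → r x y ∧ not (t x y))
    ≡⟨ cong₂ _+_ (sum-cong-≗ λ x → countTrue≡∑ (λ y → r x y ∧ t x y))
                 (sum-cong-≗ λ y → countTrue≡∑ (λ x → r x y ∧ not (t x y))) ⟩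
  ∑[ x < m ] ∑[ y < n ] 𝟙 x y + ∑[ y < n ] ∑[ x < m ] 𝟙̸ x y
    ≡⟨ cong (∑[ x < m ] ∑[ y < n ] 𝟙 x y +_) (∑-comm 𝟙̸) ⟨
  ∑[ x < m ] ∑[ y < n ] 𝟙 x y + ∑[ x < m ] ∑[ y < n ] 𝟙̸ x y
    ≡⟨ ∑-distrib-+ (λ x → ∑[ y < n ] 𝟙 x y) (λ x → ∑[ y < n ] 𝟙̸ x y) ⟨
  ∑[ x < m ] (∑[ y < n ] 𝟙 x y + ∑[ y < n ] 𝟙̸ x y)
    ≡⟨ sum-cong-≗ (λ x → ∑-distrib-+ (𝟙 x) (𝟙̸ x)) ⟨
  ∑[ x < m ] ∑[ y < n ] (𝟙 x y + 𝟙̸ x y)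
    ≡⟨ sum-cong-≗ (λ x → sum-cong-≗ λ y → indicator-split (r x y) (t x y)) ⟩
  ∑[ x < m ] ∑[ y < n ] indicator (r x y)
    ≡⟨ sum-cong-≗ (λ x → countTrue≡∑ (r x)) ⟨
  ∑[ x < m ] countTrue (r x) ∎
  where
  open ≡-Reasoning
  𝟙 𝟙̸ : Fin m → Fin n → ℕ
  𝟙  x y = indicator (r x y ∧ t x y)
  𝟙̸ x y = indicator (r x y ∧ not (t x y))
  indicator-split : ∀ a b → indicator (a ∧ b) + indicator (a ∧ not b) ≡ indicator a
  indicator-split true  true  = refl
  indicator-split true  false = refl
  indicator-split false _     = refl

module Symmetries {v : ℕ} (inc : Fin v → Fin v → Bool) where

  module Aut  = Automorphism
  module Anti = AntiAutomorphism

  Symmetry : Set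
  Symmetry = Automorphism v inc ⊎ AntiAutomorphism v inc

  act : Symmetry → Vertex v → Vertex v
  act (inj₁ g) (inj₁ x) = inj₁ (Aut.σ g ⟨$⟩ʳ x)
  act (inj₁ g) (inj₂ Y) = inj₂ (Aut.τ g ⟨$⟩ʳ Y)
  act (inj₂ h) (inj₁ x) = inj₂ (Anti.α h ⟨$⟩ʳ x)
  act (inj₂ h) (inj₂ Y) = inj₁ (Anti.β h ⟨$⟩ʳ Y)

  infixr 9 _·_

  _·_ : Symmetry → Symmetry → Symmetry
  inj₁ g · inj₁ h = inj₁ record
    { σ = Aut.σ h ∘ₚ Aut.σ g ; τ = Aut.τ h ∘ₚ Aut.τ g
    ; preserves = λ x Y → trans (Aut.preserves g _ _) (Aut.preserves h x Y) }
  inj₁ g · inj₂ h = inj₂ record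
    { α = Anti.α h ∘ₚ Aut.τ g ; β = Anti.β h ∘ₚ Aut.σ g
    ; preserves = λ x Y → trans (Aut.preserves g _ _) (Anti.preserves h x Y) }
  inj₂ g · inj₁ h = inj₂ record
    { α = Aut.σ h ∘ₚ Anti.α g ; β = Aut.τ h ∘ₚ Anti.β g
    ; preserves = λ x Y → trans (Anti.preserves g _ _) (Aut.preserves h x Y) }
  inj₂ g · inj₂ h = inj₁ record
    { σ = Anti.α h ∘ₚ Anti.β g ; τ = Anti.β h ∘ₚ Anti.α g
    ; preserves = λ x Y → trans (Anti.preserves g _ _) (Anti.preserves h x Y) }

  act-· : ∀ g h z → act (g · h) z ≡ act g (act h z)
  act-· (inj₁ _) (inj₁ _) (inj₁ _) = refl
  act-· (inj₁ _) (inj₁ _) (inj₂ _) = refl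
  act-· (inj₁ _) (inj₂ _) (inj₁ _) = refl
  act-· (inj₁ _) (inj₂ _) (inj₂ _) = refl
  act-· (inj₂ _) (inj₁ _) (inj₁ _) = refl
  act-· (inj₂ _) (inj₁ _) (inj₂ _) = refl
  act-· (inj₂ _) (inj₂ _) (inj₁ _) = refl
  act-· (inj₂ _) (inj₂ _) (inj₂ _) = refl

  inv : Symmetry → Symmetry
  inv (inj₁ g) = inj₁ record
    { σ = flip σ ; τ = flip τ
    ; preserves = λ x Y → trans (sym (preserves _ _)) (cong₂ inc (inverseʳ σ) (inverseʳ τ)) }
    where open Automorphism g
  inv (inj₂ h) = inj₂ record
    { α = flip β ; β = flip α
    ; preserves = λ x Y → trans (sym (preserves _ _)) (cong₂ inc (inverseʳ β) (inverseʳ α)) }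
    where open AntiAutomorphism h

  act-inv : ∀ g z → act (inv g) (act g z) ≡ z
  act-inv (inj₁ g) (inj₁ _) = cong inj₁ (inverseˡ (Aut.σ g))
  act-inv (inj₁ g) (inj₂ _) = cong inj₂ (inverseˡ (Aut.τ g))
  act-inv (inj₂ h) (inj₁ _) = cong inj₁ (inverseˡ (Anti.α h))
  act-inv (inj₂ h) (inj₂ _) = cong inj₂ (inverseˡ (Anti.β h))

  neighbour : Vertex v → Fin v → Vertex v
  neighbour (inj₁ _) = inj₂
  neighbour (inj₂ _) = inj₁

  incident : Vertex v → Fin v → Bool
  incident (inj₁ x) Y = inc x Y
  incident (inj₂ Y) x = inc x Y

  relabel : Symmetry → Vertex v → Permutation′ v
  relabel (inj₁ g) (inj₁ _) = Aut.τ g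
  relabel (inj₁ g) (inj₂ _) = Aut.σ g
  relabel (inj₂ h) (inj₁ _) = Anti.β h
  relabel (inj₂ h) (inj₂ _) = Anti.α h

  act-neighbour : ∀ g z i → act g (neighbour z i) ≡ neighbour (act g z) (relabel g z ⟨$⟩ʳ i)
  act-neighbour (inj₁ _) (inj₁ _) _ = refl
  act-neighbour (inj₁ _) (inj₂ _) _ = refl
  act-neighbour (inj₂ _) (inj₁ _) _ = refl
  act-neighbour (inj₂ _) (inj₂ _) _ = refl

  incident-relabel : ∀ g z i → incident (act g z) (relabel g z ⟨$⟩ʳ i) ≡ incident z i
  incident-relabel (inj₁ g) (inj₁ x) Y = Aut.preserves g x Y
  incident-relabel (inj₁ g) (inj₂ Y) x = Aut.preserves g x Y
  incident-relabel (inj₂ h) (inj₁ x) Y = Anti.preserves h x Y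
  incident-relabel (inj₂ h) (inj₂ Y) x = Anti.preserves h x Y

module FlagOrientation {v : ℕ} {inc : Fin v → Fin v → Bool}
  (conf : IsConfiguration v inc) (wft : WeaklyFlagTransitive v inc)
  {p B : Fin v} (pB : inc p B ≡ true) where

  open Symmetries inc
  open IsConfiguration conf

  InOrbit : Vertex v → Vertex v → Set
  InOrbit u w = Σ Symmetry λ g → act g (inj₁ p) ≡ u × act g (inj₂ B) ≡ w

  Swappable : Set
  Swappable = InOrbit (inj₂ B) (inj₁ p)

  -- Constructively, "assume no swap exists" becomes the left-biased monad Swappable ⊎_.
  open RawMonad (SumLeft.monad Swappable 0ℓ) using (_>>=_; pure)

  InOrbit-act : ∀ g {u w} → InOrbit u w → InOrbit (act g u) (act g w)
  InOrbit-act g (h , refl , refl) = g · h , act-· g h _ , act-· g h _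

  swappable-from-both : ∀ {u w} → InOrbit u w → InOrbit w u → Swappable
  swappable-from-both (g , refl , refl) o =
    subst₂ InOrbit (act-inv g _) (act-inv g _) (InOrbit-act (inv g) o)

  classify : ∀ x Y → inc x Y ≡ true → InOrbit (inj₁ x) (inj₂ Y) ⊎ InOrbit (inj₂ Y) (inj₁ x)
  classify x Y xY with wft p B x Y pB xY
  ... | inj₁ (g , gp , gB) = inj₁ (inj₁ g , cong inj₁ gp , cong inj₂ gB)
  ... | inj₂ (h , hp , hB) = inj₂ (inj₂ h , cong inj₂ hp , cong inj₁ hB)

  orientation : ∀ {x Y} b → inc x Y ≡ b → Bool
  orientation         false _  = false
  orientation {x} {Y} true  xY with classify x Y xY
  ... | inj₁ _ = true
  ... | inj₂ _ = false

  pointForward : Fin v → Fin v → Bool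
  pointForward x Y = orientation (inc x Y) refl

  forward : Vertex v → Fin v → Bool
  forward (inj₁ x) Y = pointForward x Y
  forward (inj₂ Y) x = not (pointForward x Y)

  Oriented : Vertex v → Fin v → Bool → Set
  Oriented z i true  = InOrbit z (neighbour z i)
  Oriented z i false = InOrbit (neighbour z i) z

  orientation-oriented : ∀ {x Y} b (xY : inc x Y ≡ b) → b ≡ true → Oriented (inj₁ x) Y (orientation b xY)
  orientation-oriented {x} {Y} true xY _ with classify x Y xY
  ... | inj₁ o = o
  ... | inj₂ o = o

  pointForward-oriented : ∀ x Y → inc x Y ≡ true → Oriented (inj₁ x) Y (pointForward x Y)
  pointForward-oriented x Y = orientation-oriented (inc x Y) refl

  forward-oriented : ∀ z i → incident z i ≡ true → Oriented z i (forward z i)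
  forward-oriented (inj₁ x) Y xY = pointForward-oriented x Y xY
  forward-oriented (inj₂ Y) x xY with pointForward x Y | pointForward-oriented x Y xY
  ... | true  | o = o
  ... | false | o = o

  Oriented-act : ∀ g z i {b} → Oriented z i b → Oriented (act g z) (relabel g z ⟨$⟩ʳ i) b
  Oriented-act g z i {true}  o = subst (InOrbit (act g z)) (act-neighbour g z i) (InOrbit-act g o)
  Oriented-act g z i {false} o = subst (λ w → InOrbit w (act g z)) (act-neighbour g z i) (InOrbit-act g o)

  Oriented-unique : ∀ {z i b b′} → Oriented z i b → Oriented z i b′ → Swappable ⊎ b ≡ b′
  Oriented-unique {b = true}  {true}  _ _  = inj₂ refl
  Oriented-unique {b = false} {false} _ _  = inj₂ refl
  Oriented-unique {b = true}  {false} o o′ = inj₁ (swappable-from-both o o′)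
  Oriented-unique {b = false} {true}  o o′ = inj₁ (swappable-from-both o o′)

  forward-act : ∀ g z i → let j = relabel g z ⟨$⟩ʳ i in
    Swappable ⊎ (incident z i ∧ forward z i ≡ incident (act g z) j ∧ forward (act g z) j)
  forward-act g z i rewrite incident-relabel g z i with incident z i in zi
  ... | false = inj₂ refl
  ... | true  = Oriented-unique (Oriented-act g z i (forward-oriented z i zi))
                  (forward-oriented (act g z) _ (trans (incident-relabel g z i) zi))

  outDegree : Vertex v → ℕ
  outDegree z = countTrue (λ i → incident z i ∧ forward z i)

  outDegree-act : ∀ g z → Swappable ⊎ outDegree (act g z) ≡ outDegree z
  outDegree-act g z = do
    eqs ← sequenceFin (forward-act g z)
    pure (sym (trans (countTrue-cong eqs) (sym (countTrue-permute _ (relabel g z)))))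

  InOrbit-outDegree : ∀ {u w} → InOrbit u w →
    Swappable ⊎ (outDegree u ≡ outDegree (inj₁ p) × outDegree w ≡ outDegree (inj₂ B))
  InOrbit-outDegree (g , refl , refl) = do
    eu ← outDegree-act g (inj₁ p)
    ew ← outDegree-act g (inj₂ B)
    pure (eu , ew)

  Endpoints : ℕ → ℕ → Set
  Endpoints m n = (m ≡ outDegree (inj₁ p) × n ≡ outDegree (inj₂ B))
                ⊎ (m ≡ outDegree (inj₂ B) × n ≡ outDegree (inj₁ p))

  Oriented-endpoints : ∀ z i {b} → Oriented z i b →
    Swappable ⊎ Endpoints (outDegree z) (outDegree (neighbour z i))
  Oriented-endpoints z i {true}  o = map₂ inj₁ (InOrbit-outDegree o)
  Oriented-endpoints z i {false} o = map₂ (λ (ew , ez) → inj₂ (ez , ew)) (InOrbit-outDegree o)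

  expected : Vertex v → ℕ
  expected (inj₁ _) = outDegree (inj₁ p)
  expected (inj₂ _) = outDegree (inj₂ B)

  expected-endpoints : ∀ z i → Endpoints (expected z) (expected (neighbour z i))
  expected-endpoints (inj₁ _) _ = inj₁ (refl , refl)
  expected-endpoints (inj₂ _) _ = inj₂ (refl , refl)

  outDegree≡expected-step : ∀ z i → incident z i ≡ true → outDegree z ≡ expected z →
    Swappable ⊎ outDegree (neighbour z i) ≡ expected (neighbour z i)
  outDegree≡expected-step z i zi ez = do
    ends ← Oriented-endpoints z i (forward-oriented z i zi)
    pure (pair-cancel ends (expected-endpoints z i) ez)

  outDegree≡expected-reach : ∀ {u w} → Reach inc u w → outDegree u ≡ expected u →
    Swappable ⊎ outDegree w ≡ expected w
  outDegree≡expected-reach (here _) eu = pure eu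
  outDegree≡expected-reach (step (pb x Y xY) r) ex =
    outDegree≡expected-step (inj₁ x) Y xY ex >>= outDegree≡expected-reach r
  outDegree≡expected-reach (step (bp x Y xY) r) eY =
    outDegree≡expected-step (inj₂ Y) x xY eY >>= outDegree≡expected-reach r

  outDegree≡expected : ∀ z → Swappable ⊎ outDegree z ≡ expected z
  outDegree≡expected z = outDegree≡expected-reach (connected (inj₁ p) z) refl

  ∑-outDegree : ∑[ x < v ] outDegree (inj₁ x) + ∑[ Y < v ] outDegree (inj₂ Y) ≡ v * 3
  ∑-outDegree = trans (∑-countTrue-split inc pointForward)
                      (trans (sum-cong-≗ pointDegree) (∑-const v 3))

  outDegree-sum : (∀ x → outDegree (inj₁ x) ≡ outDegree (inj₁ p)) →
                  (∀ Y → outDegree (inj₂ Y) ≡ outDegree (inj₂ B)) →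
                  outDegree (inj₁ p) + outDegree (inj₂ B) ≡ 3
  outDegree-sum points blocks = *-cancelˡ-≡ _ _ v {{nonZeroIndex p}} (begin
    v * (d₁ + d₂)                                                 ≡⟨ *-distribˡ-+ v d₁ d₂ ⟩
    v * d₁ + v * d₂                                               ≡⟨ cong₂ _+_ (∑-const v d₁) (∑-const v d₂) ⟨
    ∑[ x < v ] d₁ + ∑[ Y < v ] d₂                                 ≡⟨ cong₂ _+_ (sum-cong-≗ points) (sum-cong-≗ blocks) ⟨
    ∑[ x < v ] outDegree (inj₁ x) + ∑[ Y < v ] outDegree (inj₂ Y) ≡⟨ ∑-outDegree ⟩
    v * 3                                                         ∎)
    where
    open ≡-Reasoning
    d₁ = outDegree (inj₁ p)
    d₂ = outDegree (inj₂ B)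

  InOrbit⇒automorphism : ∀ {q C} → InOrbit (inj₁ q) (inj₂ C) →
    Σ (Automorphism v inc) λ g → (Aut.σ g ⟨$⟩ʳ p ≡ q) × (Aut.τ g ⟨$⟩ʳ B ≡ C)
  InOrbit⇒automorphism (inj₁ g , refl , refl) = g , refl , refl

  swappable : ∀ {q C} → InOrbit (inj₂ C) (inj₁ q) → Swappable
  swappable {C = C} o = [ id , ⊥-elim ]′ (do
    (C↦d₁ , _) ← InOrbit-outDegree o
    C↦d₂       ← outDegree≡expected (inj₂ C)
    points     ← sequenceFin (outDegree≡expected ∘ inj₁)
    blocks     ← sequenceFin (outDegree≡expected ∘ inj₂)
    let d₁≡d₂ = trans (sym C↦d₁) C↦d₂
    pure (n+n≢3 d₁ (trans (cong (d₁ +_) d₁≡d₂) (outDegree-sum points blocks))))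
    where d₁ = outDegree (inj₁ p)

proposition4p1 : (v : ℕ) (inc : Fin v → Fin v → Bool) →
    IsConfiguration v inc → WeaklyFlagTransitive v inc → FlagTransitive v inc
proposition4p1 v inc conf wft p B q C pB qC with wft p B q C pB qC
... | inj₁ automorphism = automorphism
... | inj₂ (h , refl , refl) =
  InOrbit⇒automorphism (InOrbit-act (inj₂ h) (swappable (inj₂ h , refl , refl)))
  where
  open Symmetries inc
  open FlagOrientation conf wft pB
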